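{- Let $G$ be a finite group and let $\Gamma=\mathrm{Cay}(G,S)$ be a connected bipartite Cayley graph; let $H$ be the part (colour class) of $\Gamma$ containing the identity element (so $H$ is a subgroup of index $2$ in $G$ and $S\subseteq G\setminus H$). Let $G'$ be a group containing $H$ as a normal subgroup of index $2$ together with an element $c \in G'\setminus H$ with $c^2=e$, so that $G' = H\rtimes\langle c\rangle$. Fix $a \in G\setminus H$, let $T_a = Sa^{ -1} \subseteq H$ and $S' = T_a c = \{tc : t\in T_a\}\subseteq G'$. If $S'$ is inverse-closed in $G'$, then the Cayley graph $\mathrm{Cay}(G',S')$ is isomorphic to $\mathrm{Cay}(G,S)$.
   Context: For a finite group $G$ and an inverse-closed subset $S\subseteq G\setminus\{e\}$, the Cayley graph $\mathrm{Cay}(G,S)$ has vertex set $G$, with $a$ adjacent to $b$ if and only if $ab^{ -1}\in S$. -}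

module Defs where

open import Level using (Level; _⊔_; suc)
open import Algebra.Bundles using (Group)
open import Data.Bool using (Bool)
open import Data.Fin using (Fin)
open import Data.Product using (Σ; ∃; _×_; _,_)
open import Data.Sum using (_⊎_)
open import Relation.Nullary using (¬_)
open import Relation.Binary.PropositionalEquality as ≡ using (_≡_; _≢_)
open import Relation.Binary.Construct.Closure.ReflexiveTransitive using (Star)
open import Function.Bundles using (Inverse)

module _ {c ℓ : Level} (G : Group c ℓ) where
  open Group G

  IsFiniteGroup : Set (c ⊔ ℓ)
  IsFiniteGroup = Σ _ λ n → Inverse (≡.setoid (Fin n)) setoid

  record IsConnectionSet {s : Level} (S : Carrier → Set s) : Set (c ⊔ ℓ ⊔ s) where
    field
      respects   : ∀ {x y} → x ≈ y → S x → S y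
      noIdentity : ∀ {x} → S x → ¬ (x ≈ ε)
      invClosed  : ∀ {x} → S x → S (x ⁻¹)

  CayAdj : {s : Level} → (Carrier → Set s) → Carrier → Carrier → Set s
  CayAdj S a b = S (a ∙ b ⁻¹)

  CayConnected : {s : Level} → (Carrier → Set s) → Set (c ⊔ s)
  CayConnected S = ∀ a b → Star (CayAdj S) a b

  IsBipartition : {s : Level} → (Carrier → Set s) → (Carrier → Bool) → Set (c ⊔ ℓ ⊔ s)
  IsBipartition S χ =
    (∀ {x y} → x ≈ y → χ x ≡ χ y) ×
    (∀ a b → CayAdj S a b → χ a ≢ χ b)

CayIso : {c ℓ c' ℓ' s s' : Level} →
         (G : Group c ℓ) → (Group.Carrier G → Set s) →
         (G' : Group c' ℓ') → (Group.Carrier G' → Set s') →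
         Set (c ⊔ ℓ ⊔ c' ⊔ ℓ' ⊔ s ⊔ s')
CayIso G S G' S' =
  Σ (Inverse (Group.setoid G) (Group.setoid G')) λ φ →
    ∀ a b → (CayAdj G S a b → CayAdj G' S' (Inverse.to φ a) (Inverse.to φ b)) ×
            (CayAdj G' S' (Inverse.to φ a) (Inverse.to φ b) → CayAdj G S a b)

-- H ⊆ G is given as a predicate; ι is a map G → G' that is only required
-- to be an injective homomorphism on H.

record IsIndexTwoExtension {c ℓ c' ℓ' h : Level}
    (G : Group c ℓ) (H : Group.Carrier G → Set h)
    (G' : Group c' ℓ') (ι : Group.Carrier G → Group.Carrier G')
    (c₀ : Group.Carrier G') : Set (c ⊔ ℓ ⊔ c' ⊔ ℓ' ⊔ h) where
  private
    module G  = Group G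
    module G' = Group G'
  field
    ι-cong   : ∀ {x y} → H x → H y → x G.≈ y → ι x G'.≈ ι y
    ι-inj    : ∀ {x y} → H x → H y → ι x G'.≈ ι y → x G.≈ y
    ι-hom    : ∀ {x y} → H x → H y → ι (x G.∙ y) G'.≈ (ι x G'.∙ ι y)
    normal   : ∀ g' {h} → H h →
               ∃ λ h' → H h' × ((g' G'.∙ ι h) G'.∙ (g' G'.⁻¹) G'.≈ ι h')
    c∉H      : ∀ {h} → H h → ¬ (c₀ G'.≈ ι h)
    c²≈e     : (c₀ G'.∙ c₀) G'.≈ G'.ε
    cosets   : ∀ g' → ∃ λ h → H h × ((g' G'.≈ ι h) ⊎ (g' G'.≈ (ι h G'.∙ c₀)))

-- Right translation by g is an automorphism of the connected bipartite graph
-- Cay(G,S), so it either fixes both colour classes or swaps them; hence the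
-- colour class H of e is a subgroup of index 2 and S ⊆ G ∖ H.  The map
-- φ h = h on H and φ g = c (a g) off H is a bijection G → G' = H ⊔ c H.
-- For h ∈ H and g ∉ H one has φ h (φ g)⁻¹ = h (a g)⁻¹ c with h (a g)⁻¹ a = h g⁻¹,
-- so h ~ g in Cay(G,S) iff φ h ~ φ g in Cay(G',S'); the remaining pairs are
-- adjacent in neither graph, because S avoids H and S' lies in the coset H c.
module Submission where

open import Defs
open import Level using (Level; _⊔_)
open import Algebra.Bundles using (Group)
open import Data.Bool using (Bool)
open import Data.Bool.Properties using (¬-not; _≟_)
open import Data.Product using (∃; _×_; _,_; proj₁; proj₂)
open import Data.Sum using (inj₁; inj₂)
open import Data.Empty using (⊥-elim)
open import Function using (_∘_; id)
open import Function.Bundles using (Inverse; Equivalence; _⇔_; mk⇔)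
open import Function.Construct.Composition using (_⇔-∘_)
open import Relation.Nullary using (¬_; Dec; yes; no)
open import Relation.Binary.PropositionalEquality as ≡ using (_≡_; _≢_)
open import Relation.Binary.Construct.Closure.ReflexiveTransitive using (Star; fold)
import Algebra.Properties.Group as GroupProperties

≢-≢⇒≡ : ∀ {x y z : Bool} → x ≢ z → y ≢ z → x ≡ y
≢-≢⇒≡ x≢z y≢z = ≡.trans (¬-not x≢z) (≡.sym (¬-not y≢z))

¬-¬⇒⇔ : ∀ {a b} {A : Set a} {B : Set b} → ¬ A → ¬ B → A ⇔ B
¬-¬⇒⇔ ¬a ¬b = mk⇔ (⊥-elim ∘ ¬a) (⊥-elim ∘ ¬b)

record IsSubgroup {c ℓ h : Level} (G : Group c ℓ) (H : Group.Carrier G → Set h)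
    : Set (c ⊔ ℓ ⊔ h) where
  open Group G
  field
    cong      : ∀ {x y} → x ≈ y → H x → H y
    ε-closed  : H ε
    ∙-closed  : ∀ {x y} → H x → H y → H (x ∙ y)
    ⁻¹-closed : ∀ {x} → H x → H (x ⁻¹)

module GroupIdentities {c ℓ : Level} (G : Group c ℓ) where
  open Group G
  open GroupProperties G using (⁻¹-anti-homo-∙)

  x//[y∙z]≈x//z//y : ∀ x y z → x // (y ∙ z) ≈ (x // z) // y
  x//[y∙z]≈x//z//y x y z =
    trans (∙-congˡ (⁻¹-anti-homo-∙ y z)) (sym (assoc x (z ⁻¹) (y ⁻¹)))

  [x∙y]//[x∙z]≈x∙[y//z]//x : ∀ x y z → (x ∙ y) // (x ∙ z) ≈ (x ∙ (y // z)) // x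
  [x∙y]//[x∙z]≈x∙[y//z]//x x y z =
    trans (x//[y∙z]≈x//z//y (x ∙ y) x z) (∙-congʳ (assoc x y (z ⁻¹)))

module CayleyGraph {c ℓ s : Level} (G : Group c ℓ) (S : Group.Carrier G → Set s)
    (S-resp : ∀ {x y} → Group._≈_ G x y → S x → S y) where
  open Group G
  open GroupProperties G using (⁻¹-anti-homo-//; //-rightDividesʳ)
  open GroupIdentities G

  S-cong : ∀ {x y} → x ≈ y → S x ⇔ S y
  S-cong x≈y = mk⇔ (S-resp x≈y) (S-resp (sym x≈y))

  CayAdj-∙ʳ : ∀ g {x y} → CayAdj G S x y → CayAdj G S (x ∙ g) (y ∙ g)
  CayAdj-∙ʳ g {x} {y} =
    S-resp (sym (trans (x//[y∙z]≈x//z//y (x ∙ g) y g) (∙-congʳ (//-rightDividesʳ g x))))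

  CayAdj-sym : (∀ {x} → S x → S (x ⁻¹)) → ∀ {x y} → CayAdj G S x y ⇔ CayAdj G S y x
  CayAdj-sym S-inv {x} {y} = mk⇔ (S-resp (⁻¹-anti-homo-// x y) ∘ S-inv)
                                 (S-resp (⁻¹-anti-homo-// y x) ∘ S-inv)

module Bipartition {c ℓ s : Level} (G : Group c ℓ) (S : Group.Carrier G → Set s)
    (S-conn : IsConnectionSet G S) (connected : CayConnected G S)
    (χ : Group.Carrier G → Bool) (bipartition : IsBipartition G S χ) where
  open Group G
  open IsConnectionSet S-conn
  open CayleyGraph G S respects
  open GroupProperties G using (ε⁻¹≈ε)

  χ-cong : ∀ {x y} → x ≈ y → χ x ≡ χ y
  χ-cong = proj₁ bipartition

  χ-proper : ∀ x y → CayAdj G S x y → χ x ≢ χ y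
  χ-proper = proj₂ bipartition

  Even : Carrier → Set
  Even g = χ g ≡ χ ε

  Even? : ∀ g → Dec (Even g)
  Even? g = χ g ≟ χ ε

  ∙ʳ-fixesColour-along : ∀ g {x y} → Star (CayAdj G S) x y →
                         χ (x ∙ g) ≡ χ x → χ (y ∙ g) ≡ χ y
  ∙ʳ-fixesColour-along g =
    fold (λ x y → χ (x ∙ g) ≡ χ x → χ (y ∙ g) ≡ χ y) (λ x~y k → k ∘ step x~y) id
    where
    step : ∀ {x y} → CayAdj G S x y → χ (x ∙ g) ≡ χ x → χ (y ∙ g) ≡ χ y
    step {x} {y} x~y fixed =
      ≢-≢⇒≡ (λ e → χ-proper (x ∙ g) (y ∙ g) (CayAdj-∙ʳ g x~y) (≡.trans fixed (≡.sym e)))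
             (χ-proper x y x~y ∘ ≡.sym)

  ∙ʳ-fixesColour⇔Even : ∀ x g → (χ (x ∙ g) ≡ χ x) ⇔ Even g
  ∙ʳ-fixesColour⇔Even x g = mk⇔
    (λ fixed → ≡.trans (χ-cong (sym (identityˡ g)))
                       (∙ʳ-fixesColour-along g (connected x ε) fixed))
    (λ even → ∙ʳ-fixesColour-along g (connected ε x) (≡.trans (χ-cong (identityˡ g)) even))

  Even⇒fixesColour : ∀ {x g} → Even g → χ (x ∙ g) ≡ χ x
  Even⇒fixesColour {x} {g} = Equivalence.from (∙ʳ-fixesColour⇔Even x g)

  fixesColour⇒Even : ∀ {x g} → χ (x ∙ g) ≡ χ x → Even g
  fixesColour⇒Even {x} {g} = Equivalence.to (∙ʳ-fixesColour⇔Even x g)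

  Even-isSubgroup : IsSubgroup G Even
  Even-isSubgroup = record
    { cong      = λ x≈y even → ≡.trans (χ-cong (sym x≈y)) even
    ; ε-closed  = ≡.refl
    ; ∙-closed  = λ even-x even-y → ≡.trans (Even⇒fixesColour even-y) even-x
    ; ⁻¹-closed = λ {x} even → fixesColour⇒Even (≡.trans (χ-cong (inverseʳ x)) (≡.sym even))
    }

  odd∙odd⇒Even : ∀ {x y} → ¬ Even x → ¬ Even y → Even (x ∙ y)
  odd∙odd⇒Even odd-x odd-y = ≢-≢⇒≡ (odd-y ∘ fixesColour⇒Even) (odd-x ∘ ≡.sym)

  odd∙even⇒odd : ∀ {x y} → ¬ Even x → Even y → ¬ Even (x ∙ y)
  odd∙even⇒odd odd-x even-y even-xy = odd-x (≡.trans (≡.sym (Even⇒fixesColour even-y)) even-xy)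

  odd⇒odd⁻¹ : ∀ {x} → ¬ Even x → ¬ Even (x ⁻¹)
  odd⇒odd⁻¹ {x} odd-x even-x⁻¹ =
    odd-x (≡.trans (≡.sym (Even⇒fixesColour even-x⁻¹)) (χ-cong (inverseʳ x)))

  S⇒odd : ∀ {x} → S x → ¬ Even x
  S⇒odd {x} Sx = χ-proper x ε (respects (∙-congˡ (sym ε⁻¹≈ε)) (respects (sym (identityʳ x)) Sx))

module IndexTwoExtension {c ℓ c' ℓ' h : Level}
    {G : Group c ℓ} {H : Group.Carrier G → Set h} (H-sub : IsSubgroup G H)
    {G' : Group c' ℓ'} {ι : Group.Carrier G → Group.Carrier G'} {c₀ : Group.Carrier G'}
    (ext : IsIndexTwoExtension G H G' ι c₀) where
  open Group G
  private module G' = Group G'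
  open IsSubgroup H-sub
  open IsIndexTwoExtension ext
  open GroupProperties G' using
    (identityˡ-unique; inverseˡ-unique; x≈z//y; y≈x\\z; \\-leftDividesʳ)
  open import Relation.Binary.Reasoning.Setoid G'.setoid

  ι-ε : ι ε G'.≈ G'.ε
  ι-ε = identityˡ-unique (ι ε) (ι ε)
    (G'.trans (G'.sym (ι-hom ε-closed ε-closed)) (ι-cong (∙-closed ε-closed ε-closed) ε-closed (identityˡ ε)))

  ι-⁻¹ : ∀ {x} → H x → ι (x ⁻¹) G'.≈ ι x G'.⁻¹
  ι-⁻¹ {x} Hx = inverseˡ-unique (ι (x ⁻¹)) (ι x) (begin
    ι (x ⁻¹) G'.∙ ι x ≈⟨ ι-hom (⁻¹-closed Hx) Hx ⟨
    ι (x ⁻¹ ∙ x)      ≈⟨ ι-cong (∙-closed (⁻¹-closed Hx) Hx) ε-closed (inverseˡ x) ⟩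
    ι ε               ≈⟨ ι-ε ⟩
    G'.ε              ∎)

  ι-// : ∀ {x y} → H x → H y → ι (x // y) G'.≈ ι x G'.// ι y
  ι-// Hx Hy = G'.trans (ι-hom Hx (⁻¹-closed Hy)) (G'.∙-congˡ (ι-⁻¹ Hy))

  ι-\\ : ∀ {x y} → H x → H y → ι (x \\ y) G'.≈ ι x G'.\\ ι y
  ι-\\ Hx Hy = G'.trans (ι-hom (⁻¹-closed Hx) Hy) (G'.∙-congʳ (ι-⁻¹ Hx))

  c₀⁻¹≈c₀ : c₀ G'.⁻¹ G'.≈ c₀
  c₀⁻¹≈c₀ = G'.sym (inverseˡ-unique c₀ c₀ c²≈e)

  ι∙c₀≉ι : ∀ {x y} → H x → H y → ¬ (ι x G'.∙ c₀ G'.≈ ι y)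
  ι∙c₀≉ι Hx Hy e =
    c∉H (∙-closed (⁻¹-closed Hx) Hy) (G'.trans (y≈x\\z _ _ _ e) (G'.sym (ι-\\ Hx Hy)))

  c₀∙ι≉ι : ∀ {x y} → H x → H y → ¬ (c₀ G'.∙ ι x G'.≈ ι y)
  c₀∙ι≉ι Hx Hy e =
    c∉H (∙-closed Hy (⁻¹-closed Hx)) (G'.trans (x≈z//y _ _ _ e) (G'.sym (ι-// Hy Hx)))

  conj : ∀ {x} → H x → Carrier
  conj Hx = proj₁ (normal c₀ Hx)

  conj∈H : ∀ {x} (Hx : H x) → H (conj Hx)
  conj∈H Hx = proj₁ (proj₂ (normal c₀ Hx))

  c₀∙ι//c₀≈ι-conj : ∀ {x} (Hx : H x) → (c₀ G'.∙ ι x) G'.// c₀ G'.≈ ι (conj Hx)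
  c₀∙ι//c₀≈ι-conj Hx = proj₂ (proj₂ (normal c₀ Hx))

  c₀∙ι-conj≈ι∙c₀ : ∀ {x} (Hx : H x) → c₀ G'.∙ ι (conj Hx) G'.≈ ι x G'.∙ c₀
  c₀∙ι-conj≈ι∙c₀ {x} Hx = begin
    c₀ G'.∙ ι (conj Hx)                        ≈⟨ G'.∙-cong (G'.sym c₀⁻¹≈c₀) (G'.sym (c₀∙ι//c₀≈ι-conj Hx)) ⟩
    c₀ G'.\\ ((c₀ G'.∙ ι x) G'.// c₀)          ≈⟨ G'.∙-congˡ (G'.assoc c₀ (ι x) (c₀ G'.⁻¹)) ⟩
    c₀ G'.\\ (c₀ G'.∙ (ι x G'.// c₀))          ≈⟨ \\-leftDividesʳ c₀ (ι x G'.// c₀) ⟩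
    ι x G'.// c₀                               ≈⟨ G'.∙-congˡ c₀⁻¹≈c₀ ⟩
    ι x G'.∙ c₀                                ∎

module Isomorphism {c ℓ c' ℓ' s : Level}
    (G : Group c ℓ) (S : Group.Carrier G → Set s) (S-conn : IsConnectionSet G S)
    (connected : CayConnected G S)
    (χ : Group.Carrier G → Bool) (bipartition : IsBipartition G S χ)
    (G' : Group c' ℓ') (ι : Group.Carrier G → Group.Carrier G') (c₀ : Group.Carrier G')
    (ext : IsIndexTwoExtension G (λ g → χ g ≡ χ (Group.ε G)) G' ι c₀)
    (a : Group.Carrier G) (odd-a : χ a ≢ χ (Group.ε G)) where
  open Group G
  module G' = Group G'
  open IsConnectionSet S-conn
  open IsIndexTwoExtension ext
  open Bipartition G S S-conn connected χ bipartition
  open IsSubgroup Even-isSubgroup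
  open IndexTwoExtension Even-isSubgroup ext
  open GroupIdentities
  open GroupProperties G using (∙-cancelˡ; \\-leftDividesˡ; //-rightDividesˡ)
  module G'ₚ = GroupProperties G'
  open import Relation.Binary.Reasoning.Setoid G'.setoid

  S' : G'.Carrier → Set (c ⊔ ℓ' ⊔ s)
  S' x = ∃ λ t → Even t × S (t ∙ a) × x G'.≈ ι t G'.∙ c₀

  S'-resp : ∀ {x y} → x G'.≈ y → S' x → S' y
  S'-resp x≈y (t , even-t , Sta , x≈tc) = t , even-t , Sta , G'.trans (G'.sym x≈y) x≈tc

  S-∙a⇔S'-ι∙c₀ : ∀ {t} → Even t → S (t ∙ a) ⇔ S' (ι t G'.∙ c₀)
  S-∙a⇔S'-ι∙c₀ {t} even-t = mk⇔
    (λ Sta → t , even-t , Sta , G'.refl)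
    (λ { (u , even-u , Sua , e) →
           respects (∙-congʳ (ι-inj even-u even-t (G'ₚ.∙-cancelʳ c₀ _ _ (G'.sym e)))) Sua })

  ¬S'-ι : ∀ {x} → Even x → ¬ S' (ι x)
  ¬S'-ι even-x (t , even-t , _ , e) = ι∙c₀≉ι even-t even-x (G'.sym e)

  φ : Carrier → G'.Carrier
  φ g with Even? g
  ... | yes _ = ι g
  ... | no  _ = c₀ G'.∙ ι (a ∙ g)

  φ-even : ∀ {g} → Even g → φ g G'.≈ ι g
  φ-even {g} even with Even? g
  ... | yes _  = G'.refl
  ... | no odd = ⊥-elim (odd even)

  φ-odd : ∀ {g} → ¬ Even g → φ g G'.≈ c₀ G'.∙ ι (a ∙ g)
  φ-odd {g} odd with Even? g
  ... | yes even = ⊥-elim (odd even)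
  ... | no  _    = G'.refl

  ψ : G'.Carrier → Carrier
  ψ x with cosets x
  ... | h , _    , inj₁ _ = h
  ... | _ , even , inj₂ _ = a \\ conj even

  φ∘ψ : ∀ x → φ (ψ x) G'.≈ x
  φ∘ψ x with cosets x
  ... | h , even , inj₁ x≈h = G'.trans (φ-even even) (G'.sym x≈h)
  ... | h , even , inj₂ x≈hc = begin
    φ (a \\ conj even)            ≈⟨ φ-odd (odd∙even⇒odd (odd⇒odd⁻¹ odd-a) (conj∈H even)) ⟩
    c₀ G'.∙ ι (a ∙ (a \\ conj even)) ≈⟨ G'.∙-congˡ (ι-cong (cong (sym a∙a\\h') h'-even) h'-even a∙a\\h') ⟩
    c₀ G'.∙ ι (conj even)          ≈⟨ c₀∙ι-conj≈ι∙c₀ even ⟩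
    ι h G'.∙ c₀                    ≈⟨ x≈hc ⟨
    x                              ∎
    where
    h'-even : Even (conj even)
    h'-even = conj∈H even
    a∙a\\h' : a ∙ (a \\ conj even) ≈ conj even
    a∙a\\h' = \\-leftDividesˡ a (conj even)

  Even-a∙odd : ∀ {g} → ¬ Even g → Even (a ∙ g)
  Even-a∙odd = odd∙odd⇒Even odd-a

  φ-cong : ∀ {x y} → x ≈ y → φ x G'.≈ φ y
  φ-cong {x} {y} x≈y with Even? x | Even? y
  ... | yes even-x | yes even-y = ι-cong even-x even-y x≈y
  ... | no  odd-x  | no  odd-y  = G'.∙-congˡ (ι-cong (Even-a∙odd odd-x) (Even-a∙odd odd-y) (∙-congˡ x≈y))
  ... | yes even-x | no  odd-y  = ⊥-elim (odd-y (cong x≈y even-x))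
  ... | no  odd-x  | yes even-y = ⊥-elim (odd-x (cong (sym x≈y) even-y))

  φ-injective : ∀ {x y} → φ x G'.≈ φ y → x ≈ y
  φ-injective {x} {y} e with Even? x | Even? y
  ... | yes even-x | yes even-y = ι-inj even-x even-y e
  ... | no  odd-x  | no  odd-y  = ∙-cancelˡ a x y
        (ι-inj (Even-a∙odd odd-x) (Even-a∙odd odd-y) (G'ₚ.∙-cancelˡ c₀ _ _ e))
  ... | yes even-x | no  odd-y  = ⊥-elim (c₀∙ι≉ι (Even-a∙odd odd-y) even-x (G'.sym e))
  ... | no  odd-x  | yes even-y = ⊥-elim (c₀∙ι≉ι (Even-a∙odd odd-x) even-y e)

  φ-inverse : Inverse setoid G'.setoid
  φ-inverse = record
    { to        = φ
    ; from      = ψ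
    ; to-cong   = φ-cong
    ; from-cong = λ {x} {y} x≈y → φ-injective (G'.trans (φ∘ψ x) (G'.trans x≈y (G'.sym (φ∘ψ y))))
    ; inverse   = (λ {x} x≈ψy → G'.trans (φ-cong x≈ψy) (φ∘ψ x))
                , (λ {x} {y} y≈φx → φ-injective (G'.trans (φ∘ψ y) y≈φx))
    }

  module Cay  = CayleyGraph G S respects
  module Cay' = CayleyGraph G' S' S'-resp

  φ//φ-even-odd : ∀ {x y} → Even x → ¬ Even y →
                  φ x G'.// φ y G'.≈ ι (x // (a ∙ y)) G'.∙ c₀
  φ//φ-even-odd {x} {y} even-x odd-y = begin
    φ x G'.// φ y                       ≈⟨ G'ₚ.//-cong₂ (φ-even even-x) (φ-odd odd-y) ⟩
    ι x G'.// (c₀ G'.∙ ι (a ∙ y))       ≈⟨ x//[y∙z]≈x//z//y G' (ι x) c₀ (ι (a ∙ y)) ⟩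
    (ι x G'.// ι (a ∙ y)) G'.// c₀      ≈⟨ G'.∙-cong (G'.sym (ι-// even-x (Even-a∙odd odd-y))) c₀⁻¹≈c₀ ⟩
    ι (x // (a ∙ y)) G'.∙ c₀            ∎

  adjacent⇔-even-odd : ∀ {x y} → Even x → ¬ Even y →
                       CayAdj G S x y ⇔ CayAdj G' S' (φ x) (φ y)
  adjacent⇔-even-odd {x} {y} even-x odd-y =
    Cay'.S-cong (G'.sym (φ//φ-even-odd even-x odd-y))
      ⇔-∘ (S-∙a⇔S'-ι∙c₀ (∙-closed even-x (⁻¹-closed (Even-a∙odd odd-y)))
      ⇔-∘ Cay.S-cong (sym t∙a≈x//y))
    where
    t∙a≈x//y : (x // (a ∙ y)) ∙ a ≈ x // y
    t∙a≈x//y = trans (∙-congʳ (x//[y∙z]≈x//z//y G x a y)) (//-rightDividesˡ a (x // y))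

  φ//φ-even-even : ∀ {x y} → Even x → Even y → ∃ λ h → Even h × φ x G'.// φ y G'.≈ ι h
  φ//φ-even-even {x} {y} even-x even-y =
    x // y , ∙-closed even-x (⁻¹-closed even-y) ,
    G'.trans (G'ₚ.//-cong₂ (φ-even even-x) (φ-even even-y)) (G'.sym (ι-// even-x even-y))

  φ//φ-odd-odd : ∀ {x y} → ¬ Even x → ¬ Even y → ∃ λ h → Even h × φ x G'.// φ y G'.≈ ι h
  φ//φ-odd-odd {x} {y} odd-x odd-y = conj even-ax//ay , conj∈H even-ax//ay , (begin
    φ x G'.// φ y                                    ≈⟨ G'ₚ.//-cong₂ (φ-odd odd-x) (φ-odd odd-y) ⟩
    (c₀ G'.∙ ι (a ∙ x)) G'.// (c₀ G'.∙ ι (a ∙ y))    ≈⟨ [x∙y]//[x∙z]≈x∙[y//z]//x G' c₀ _ _ ⟩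
    (c₀ G'.∙ (ι (a ∙ x) G'.// ι (a ∙ y))) G'.// c₀   ≈⟨ G'.∙-congʳ (G'.∙-congˡ (G'.sym (ι-// even-ax even-ay))) ⟩
    (c₀ G'.∙ ι ((a ∙ x) // (a ∙ y))) G'.// c₀        ≈⟨ c₀∙ι//c₀≈ι-conj even-ax//ay ⟩
    ι (conj even-ax//ay)                             ∎)
    where
    even-ax : Even (a ∙ x)
    even-ax = Even-a∙odd odd-x
    even-ay : Even (a ∙ y)
    even-ay = Even-a∙odd odd-y
    even-ax//ay : Even ((a ∙ x) // (a ∙ y))
    even-ax//ay = ∙-closed even-ax (⁻¹-closed even-ay)

  nonadjacent⇔ : ∀ {x y} → Even (x // y) → (∃ λ h → Even h × φ x G'.// φ y G'.≈ ι h) →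
                 CayAdj G S x y ⇔ CayAdj G' S' (φ x) (φ y)
  nonadjacent⇔ even-x//y (h , even-h , φx//φy≈ιh) =
    ¬-¬⇒⇔ (λ Sxy → S⇒odd Sxy even-x//y) (¬S'-ι even-h ∘ S'-resp φx//φy≈ιh)

  adjacent⇔ : (∀ {x} → S' x → S' (x G'.⁻¹)) →
              ∀ x y → CayAdj G S x y ⇔ CayAdj G' S' (φ x) (φ y)
  adjacent⇔ S'-inv x y = by-parity (Even? x) (Even? y)
    where
    by-parity : Dec (Even x) → Dec (Even y) → CayAdj G S x y ⇔ CayAdj G' S' (φ x) (φ y)
    by-parity (yes even-x) (no odd-y)   = adjacent⇔-even-odd even-x odd-y
    by-parity (no odd-x)   (yes even-y) =
      Cay'.CayAdj-sym S'-inv ⇔-∘ (adjacent⇔-even-odd even-y odd-x ⇔-∘ Cay.CayAdj-sym invClosed)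
    by-parity (yes even-x) (yes even-y) =
      nonadjacent⇔ (∙-closed even-x (⁻¹-closed even-y)) (φ//φ-even-even even-x even-y)
    by-parity (no odd-x)   (no odd-y)   =
      nonadjacent⇔ (odd∙odd⇒Even odd-x (odd⇒odd⁻¹ odd-y)) (φ//φ-odd-odd odd-x odd-y)

  cayIso : (∀ {x} → S' x → S' (x G'.⁻¹)) → CayIso G S G' S'
  cayIso S'-inv = φ-inverse , λ x y →
    Equivalence.to (adjacent⇔ S'-inv x y) , Equivalence.from (adjacent⇔ S'-inv x y)

lemma3p3 : {c ℓ c' ℓ' s : Level} →
    (G : Group c ℓ) → IsFiniteGroup G →
    (S : Group.Carrier G → Set s) → IsConnectionSet G S →
    CayConnected G S →
    (χ : Group.Carrier G → Bool) → IsBipartition G S χ →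
    (G' : Group c' ℓ') →
    (ι : Group.Carrier G → Group.Carrier G') →
    (cc : Group.Carrier G') →
    IsIndexTwoExtension G (λ g → χ g ≡ χ (Group.ε G)) G' ι cc →
    (a : Group.Carrier G) → χ a ≢ χ (Group.ε G) →
    let S' : Group.Carrier G' → Set (c ⊔ ℓ' ⊔ s)
        S' = λ x → ∃ λ t → (χ t ≡ χ (Group.ε G)) × S (Group._∙_ G t a) ×
                           Group._≈_ G' x (Group._∙_ G' (ι t) cc)
    in (∀ {x} → S' x → S' (Group._⁻¹ G' x)) →
       CayIso G S G' S'
lemma3p3 G _ S S-conn connected χ bipartition G' ι c₀ ext a odd-a S'-inv =
  Isomorphism.cayIso G S S-conn connected χ bipartition G' ι c₀ ext a odd-a S'-inv
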